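{- For each $S\in\mathbf{Hrs}$ and every $\mathcal{X}\subseteq\omega^\omega$: $\mathcal{X}$ is $\mathbf{\Sigma}^0_S$ if and only if $\mathcal{X}\preceq\mathcal{E}_S$, and $\mathcal{X}$ is $\mathbf{\Pi}^0_S$ if and only if $\mathcal{X}\preceq\mathcal{A}_S$.
   Context: Setting: intuitionistic mathematics (intuitionistic logic), assuming the Second Axiom of Countable Choice and induction over the inductively defined class $\mathbf{Hrs}$. Finite sequences of natural numbers are coded bijectively by natural numbers; $s\ast t$ is concatenation, $\langle\,\rangle$ the empty sequence, $\overline{\alpha}n=\langle\alpha(0),\dots,\alpha(n-1)\rangle$; $(m,n)$ is a fixed pairing bijection $\omega\times\omega\to\omega$. For $X\subseteq\omega$: $X\upharpoonright s=\{t\mid s\ast t\in X\}$; for $\alpha\in\omega^\omega$: $(\alpha\upharpoonright s)(t)=\alpha(s\ast t)$. $\mathbf{Hrs}$ is the least class of subsets of $\omega$ with $1^\ast:=\{\langle\,\rangle\}\in\mathbf{Hrs}$ and, for every sequence $S_0,S_1,\dots$ in $\mathbf{Hrs}$, $\{\langle\,\rangle\}\cup\bigcup_{m,n}\langle(m,n)\rangle\ast S_n\in\mathbf{Hrs}$. For $S\in\mathbf{Hrs}$ and $\beta\in\omega^\omega$: $\mathcal{G}^{1^\ast}_\beta=\{\alpha\mid\exists n[\beta(\overline{\alpha}n)\neq0]\}$, $\mathcal{F}^{1^\ast}_\beta=\{\alpha\mid\forall n[\beta(\overline{\alpha}n)=0]\}$, and for $S\neq1^\ast$: $\mathcal{G}^S_\beta=\bigcup_n\mathcal{F}^{S\upharpoonright\langle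 n\rangle}_{\beta\upharpoonright\langle n\rangle}$, $\mathcal{F}^S_\beta=\bigcap_n\mathcal{G}^{S\upharpoonright\langle n\rangle}_{\beta\upharpoonright\langle n\rangle}$. $\mathcal{X}$ is $\mathbf{\Sigma}^0_S$ iff $\exists\beta[\mathcal{X}=\mathcal{G}^S_\beta]$ and $\mathbf{\Pi}^0_S$ iff $\exists\beta[\mathcal{X}=\mathcal{F}^S_\beta]$. Leading sets: $\mathcal{E}_{1^\ast}=\{\alpha\mid\exists n[\alpha(\langle n\rangle)\neq0]\}$, $\mathcal{A}_{1^\ast}=\{\alpha\mid\forall n[\alpha(\langle n\rangle)=0]\}$, and for $S\neq1^\ast$: $\mathcal{E}_S=\{\alpha\mid\exists n[\alpha\upharpoonright\langle n\rangle\in\mathcal{A}_{S\upharpoonright\langle n\rangle}]\}$, $\mathcal{A}_S=\{\alpha\mid\forall n[\alpha\upharpoonright\langle n\rangle\in\mathcal{E}_{S\upharpoonright\langle n\rangle}]\}$. Functions $\varphi:\omega^\omega\to\omega^\omega$ are continuous functions given by a code in $\omega^\omega$ which determines each value $(\varphi|\alpha)(n)$ from a finite initial segment of $\alpha$. $\mathcal{X}\preceq\mathcal{Y}$ iff there is $\varphi:\omega^\omega\to\omega^\omega$ with $\forall\alpha[\alpha\in\mathcal{X}\leftrightarrow\varphi|\alpha\in\mathcal{Y}]$. -}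

module Defs where

open import Data.Nat using (ℕ; zero; suc; _∸_)
open import Data.List using (List; []; _∷_; _++_; map; upTo)
open import Data.Product using (Σ; _×_; _,_; proj₁; proj₂; ∃)
open import Relation.Binary.PropositionalEquality using (_≡_; _≢_)
open import Function.Bundles using (_↔_; Inverse; _⇔_)

Baire : Set
Baire = ℕ → ℕ

-- A fixed bijective coding of finite sequences by natural numbers and a fixed
-- pairing bijection ω×ω → ω.  The theorem is stated for an arbitrary such coding.
record Coding : Set where
  field
    seqCode  : List ℕ ↔ ℕ
    pairCode : (ℕ × ℕ) ↔ ℕ

-- Trees representing the elements of Hrs:
--   one     represents 1* = {⟨⟩}
--   node f  represents {⟨⟩} ∪ ⋃_{m,n} ⟨(m,n)⟩ ∗ f n
data Hrs : Set where
  one  : Hrs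
  node : (ℕ → Hrs) → Hrs

module WithCoding (C : Coding) where
  open Coding C

  ⌜_⌝ : List ℕ → ℕ
  ⌜ s ⌝ = Inverse.to seqCode s

  dec : ℕ → List ℕ
  dec = Inverse.from seqCode

  unpair : ℕ → ℕ × ℕ
  unpair = Inverse.from pairCode

  ⟦_⟧ : Hrs → ℕ → Set
  ⟦ one ⟧    k = k ≡ ⌜ [] ⌝
  ⟦ node f ⟧ k = (k ≡ ⌜ [] ⌝) ⊎' (Σ ℕ λ j → Σ (List ℕ) λ t →
                   (k ≡ ⌜ j ∷ t ⌝) × ⟦ f (proj₂ (unpair j)) ⟧ ⌜ t ⌝)
    where
    open import Data.Sum using () renaming (_⊎_ to _⊎'_)

  -- S ↾ ⟨j⟩ for S = node f, where j = (m , n):  S ↾ ⟨(m,n)⟩ = S_n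
  sub : (ℕ → Hrs) → ℕ → Hrs
  sub f j = f (proj₂ (unpair j))

  initSeg : Baire → ℕ → List ℕ
  initSeg α n = map α (upTo n)

  _↾_ : Baire → List ℕ → Baire
  (α ↾ s) t = α ⌜ s ++ dec t ⌝

  𝒢 ℱ : Hrs → Baire → Baire → Set
  𝒢 one      β α = ∃ λ n → β ⌜ initSeg α n ⌝ ≢ 0
  𝒢 (node f) β α = ∃ λ n → ℱ (f (proj₂ (unpair n))) (β ↾ (n ∷ [])) α
  ℱ one      β α = ∀ n → β ⌜ initSeg α n ⌝ ≡ 0
  ℱ (node f) β α = ∀ n → 𝒢 (f (proj₂ (unpair n))) (β ↾ (n ∷ [])) α

  _≐_ : (Baire → Set) → (Baire → Set) → Set
  X ≐ Y = ∀ α → X α ⇔ Y α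

  IsΣ⁰ IsΠ⁰ : Hrs → (Baire → Set) → Set
  IsΣ⁰ S X = ∃ λ β → X ≐ 𝒢 S β
  IsΠ⁰ S X = ∃ λ β → X ≐ ℱ S β

  ℰ 𝒜 : Hrs → Baire → Set
  ℰ one      α = ∃ λ n → α ⌜ n ∷ [] ⌝ ≢ 0
  ℰ (node f) α = ∃ λ n → 𝒜 (f (proj₂ (unpair n))) (α ↾ (n ∷ []))
  𝒜 one      α = ∀ n → α ⌜ n ∷ [] ⌝ ≡ 0
  𝒜 (node f) α = ∀ n → ℰ (f (proj₂ (unpair n))) (α ↾ (n ∷ []))

  -- φ ∈ ω^ω codes a continuous function ω^ω → ω^ω:
  --  for all α, n there is m with φ(⟨n⟩ ∗ ᾱm) ≠ 0, and once φ(⟨n⟩ ∗ s) ≠ 0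
  --  the value does not change on extensions of s.
  IsFun : Baire → Set
  IsFun φ = (∀ α n → ∃ λ m → φ ⌜ n ∷ initSeg α m ⌝ ≢ 0)
          × (∀ n s t → φ ⌜ n ∷ s ⌝ ≢ 0 → φ ⌜ n ∷ (s ++ t) ⌝ ≡ φ ⌜ n ∷ s ⌝)

  apply : (φ : Baire) → IsFun φ → Baire → Baire
  apply φ p α n = φ ⌜ n ∷ initSeg α (proj₁ (proj₁ p α n)) ⌝ ∸ 1

  _≼_ : (Baire → Set) → (Baire → Set) → Set
  X ≼ Y = Σ Baire λ φ → Σ (IsFun φ) λ p → ∀ α → X α ⇔ Y (apply φ p α)

-- Every 𝒢^S_β reduces to ℰ_S: at 1* the reduction sends α to the sequence
-- whose value at ⟨n⟩ is β(ᾱn); at a node the reductions of the components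
-- 𝒢^{S↾⟨n⟩}_{β↾⟨n⟩} are glued together, one on each subtree ⟨n⟩ ∗ _.
-- Conversely the preimage of ℰ_S under a continuous φ is Σ⁰_S: at 1* it is
-- open, since (φ|α)(⟨n⟩) ≠ 0 is witnessed by a finite initial segment of α;
-- at a node one restricts φ to the outputs ⟨n⟩ ∗ _ and glues the parameters
-- obtained for the subtrees.  Π⁰ at 1* is the complement of Σ⁰ because
-- equality with 0 is decidable.
module Submission where

open import Defs
open import Data.Product using (_×_)
open import Function.Bundles using (_⇔_)

open import Data.List using (List; []; _∷_; _++_; map; upTo; length; take)
open import Data.List.Properties
  using (length-map; length-upTo; upTo-∷ʳ; map-++; ++-assoc; ++-identityʳ; length-++-≤ˡ; take-all)
open import Data.Nat using (ℕ; zero; suc; _+_; _∸_; _≤_; _<_; _≤′_; ≤′-refl; ≤′-step; _≤?_; _≟_; s≤s)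
open import Data.Nat.Properties using (≤-reflexive; ≤-trans; ≤-total; ≤⇒≤′; m≤m+n; m≤n+m; anyUpTo?)
open import Data.Product using (Σ; ∃; _,_; proj₁; proj₂; map₂)
open import Data.Sum using (inj₁; inj₂)
open import Function.Base using (_∘_)
open import Function.Bundles using (Equivalence; Inverse; mk⇔)
open import Function.Properties.Equivalence using () renaming (sym to ⇔-sym; trans to ⇔-trans)
open import Function.Related.TypeIsomorphisms using (¬-cong-⇔)
open import Relation.Binary.PropositionalEquality
open import Relation.Nullary using (¬_; ¬?; Dec; yes; no; contradiction)
open import Relation.Nullary.Decidable using (decidable-stable)

open Equivalence using (to; from)

∃-cong-⇔ : {A : Set} {P Q : A → Set} → (∀ a → P a ⇔ Q a) → ∃ P ⇔ ∃ Q
∃-cong-⇔ e = mk⇔ (map₂ λ {a} → to (e a)) (map₂ λ {a} → from (e a))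

∀-cong-⇔ : {A : Set} {P Q : A → Set} → (∀ a → P a ⇔ Q a) → (∀ a → P a) ⇔ (∀ a → Q a)
∀-cong-⇔ e = mk⇔ (λ p a → to (e a) (p a)) (λ q a → from (e a) (q a))

subst-⇔ : {A : Set} (P : A → Set) {x y : A} → x ≡ y → P x ⇔ P y
subst-⇔ P x≡y = mk⇔ (subst P x≡y) (subst P (sym x≡y))

∀≡0⇔¬∃≢0 : {A : Set} (f : A → ℕ) → (∀ a → f a ≡ 0) ⇔ (¬ ∃ λ a → f a ≢ 0)
∀≡0⇔¬∃≢0 f = mk⇔ (λ zero-everywhere (a , fa≢0) → fa≢0 (zero-everywhere a))
                 (λ nowhere-nonzero a → decidable-stable (f a ≟ 0) (λ fa≢0 → nowhere-nonzero (a , fa≢0)))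

indicator : {P : Set} → Dec P → ℕ
indicator (yes _) = 1
indicator (no _)  = 0

indicator≢0⇔ : {P : Set} (P? : Dec P) → (indicator P? ≢ 0) ⇔ P
indicator≢0⇔ (yes p) = mk⇔ (λ _ → p) (λ _ ())
indicator≢0⇔ (no ¬p) = mk⇔ (λ ≢0 → contradiction refl ≢0) (λ p → contradiction p ¬p)

take-++-≤ : (n : ℕ) (s t : List ℕ) → n ≤ length s → take n (s ++ t) ≡ take n s
take-++-≤ zero    s       t _         = refl
take-++-≤ (suc n) (x ∷ s) t (s≤s n≤s) = cong (x ∷_) (take-++-≤ n s t n≤s)

module Reductions (C : Coding) where
  open Coding C
  open WithCoding C

  enc-dec : ∀ k → ⌜ dec k ⌝ ≡ k
  enc-dec k = Inverse.inverseˡ seqCode refl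

  dec-enc : ∀ s → dec ⌜ s ⌝ ≡ s
  dec-enc s = Inverse.inverseʳ seqCode refl

  length-initSeg : ∀ α n → length (initSeg α n) ≡ n
  length-initSeg α n = trans (length-map α (upTo n)) (length-upTo n)

  initSeg-suc : ∀ α n → initSeg α (suc n) ≡ initSeg α n ++ α n ∷ []
  initSeg-suc α n = trans (cong (map α) (sym (upTo-∷ʳ n))) (map-++ α (upTo n) (n ∷ []))

  initSeg-extends′ : ∀ α {m k} → m ≤′ k → ∃ λ t → initSeg α k ≡ initSeg α m ++ t
  initSeg-extends′ α ≤′-refl = [] , sym (++-identityʳ _)
  initSeg-extends′ α {m} (≤′-step {k} m≤′k) with initSeg-extends′ α m≤′k
  ... | t , ᾱk≡ᾱm++t = t ++ α k ∷ [] , (begin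
    initSeg α (suc k)                   ≡⟨ initSeg-suc α k ⟩
    initSeg α k ++ α k ∷ []             ≡⟨ cong (_++ α k ∷ []) ᾱk≡ᾱm++t ⟩
    (initSeg α m ++ t) ++ α k ∷ []      ≡⟨ ++-assoc (initSeg α m) t _ ⟩
    initSeg α m ++ t ++ α k ∷ []        ∎)
    where open ≡-Reasoning

  initSeg-extends : ∀ α {m k} → m ≤ k → ∃ λ t → initSeg α k ≡ initSeg α m ++ t
  initSeg-extends α = initSeg-extends′ α ∘ ≤⇒≤′

  -- A nonzero stage φ n s means that the prefix s determines (φ|α)(n) as
  -- stage φ n s ∸ 1; IsFun φ is definitionally IsContinuous (stage φ).
  stage : Baire → ℕ → List ℕ → ℕ
  stage φ n s = φ ⌜ n ∷ s ⌝

  IsContinuous : (ℕ → List ℕ → ℕ) → Set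
  IsContinuous Φ = (∀ α n → ∃ λ m → Φ n (initSeg α m) ≢ 0)
                 × (∀ n s t → Φ n s ≢ 0 → Φ n (s ++ t) ≡ Φ n s)

  Continuous : Set
  Continuous = Σ Baire IsFun

  _·_ : Continuous → Baire → Baire
  F · α = apply (proj₁ F) (proj₂ F) α

  stage-stable : ∀ {Φ} → IsContinuous Φ → ∀ α n {m k} →
                 Φ n (initSeg α m) ≢ 0 → m ≤ k → Φ n (initSeg α k) ≡ Φ n (initSeg α m)
  stage-stable {Φ} (_ , stable) α n {m} nz m≤k with initSeg-extends α m≤k
  ... | t , ᾱk≡ᾱm++t = trans (cong (Φ n) ᾱk≡ᾱm++t) (stable n (initSeg α m) t nz)

  ·-at : ∀ F α n m → stage (proj₁ F) n (initSeg α m) ≢ 0 →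
         (F · α) n ≡ stage (proj₁ F) n (initSeg α m) ∸ 1
  ·-at (φ , p) α n m nz with proj₁ p α n
  ... | m₀ , nz₀ with ≤-total m₀ m
  ...   | inj₁ m₀≤m = cong (_∸ 1) (sym (stage-stable p α n nz₀ m₀≤m))
  ...   | inj₂ m≤m₀ = cong (_∸ 1) (stage-stable p α n nz m≤m₀)

  -- The value at ⌜ [] ⌝ is never consulted by 𝒢, ℱ, ℰ or 𝒜; choosing 1 makes
  -- glued stage functions total there.
  glue : (ℕ → Baire) → Baire
  glue βs k with dec k
  ... | []    = 1
  ... | n ∷ s = βs n ⌜ s ⌝

  glue-∷ : ∀ βs n s → glue βs ⌜ n ∷ s ⌝ ≡ βs n ⌜ s ⌝
  glue-∷ βs n s rewrite dec-enc (n ∷ s) = refl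

  glue-↾ : ∀ βs n → (glue βs ↾ (n ∷ [])) ≗ βs n
  glue-↾ βs n t = trans (glue-∷ βs n (dec t)) (cong (βs n) (enc-dec t))

  glue-continuous : (Φs : ℕ → ℕ → List ℕ → ℕ) → (∀ n → IsContinuous (Φs n)) →
                    IsContinuous (λ k s → glue (λ n j → Φs n j s) k)
  glue-continuous Φs cs = total , stable
    where
    total : ∀ α k → ∃ λ m → glue (λ n j → Φs n j (initSeg α m)) k ≢ 0
    total α k with dec k
    ... | []    = 0 , λ ()
    ... | n ∷ s = proj₁ (cs n) α ⌜ s ⌝
    stable : ∀ k s t → glue (λ n j → Φs n j s) k ≢ 0 →
             glue (λ n j → Φs n j (s ++ t)) k ≡ glue (λ n j → Φs n j s) k
    stable k s t nz with dec k
    ... | []     = refl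
    ... | n ∷ s′ = proj₂ (cs n) ⌜ s′ ⌝ s t nz

  fromStages : (ℕ → List ℕ → ℕ) → Baire
  fromStages Φ = glue (λ n → Φ n ∘ dec)

  stage-fromStages : ∀ Φ n s → stage (fromStages Φ) n s ≡ Φ n s
  stage-fromStages Φ n s = trans (glue-∷ _ n s) (cong (Φ n) (dec-enc s))

  continuous : ∀ Φ → IsContinuous Φ → Continuous
  continuous Φ (total , stable) = fromStages Φ ,
    (λ α n → map₂ (subst (_≢ 0) (sym (stage-fromStages Φ n _))) (total α n)) ,
    (λ n s t nz → begin
      stage (fromStages Φ) n (s ++ t) ≡⟨ stage-fromStages Φ n (s ++ t) ⟩
      Φ n (s ++ t)                    ≡⟨ stable n s t (subst (_≢ 0) (stage-fromStages Φ n s) nz) ⟩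
      Φ n s                           ≡⟨ stage-fromStages Φ n s ⟨
      stage (fromStages Φ) n s        ∎)
    where open ≡-Reasoning

  continuous-· : ∀ Φ c α n m → Φ n (initSeg α m) ≢ 0 →
                 (continuous Φ c · α) n ≡ Φ n (initSeg α m) ∸ 1
  continuous-· Φ c α n m nz = trans
    (·-at (continuous Φ c) α n m (subst (_≢ 0) (sym (stage-fromStages Φ n _)) nz))
    (cong (_∸ 1) (stage-fromStages Φ n _))

  prefixStages : (ℕ → ℕ) → Baire → ℕ → List ℕ → ℕ
  prefixStages g β k s with g k ≤? length s
  ... | yes _ = suc (β ⌜ take (g k) s ⌝)
  ... | no  _ = 0

  prefixStages-long : ∀ g β k s → g k ≤ length s → prefixStages g β k s ≡ suc (β ⌜ take (g k) s ⌝)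
  prefixStages-long g β k s long with g k ≤? length s
  ... | yes _    = refl
  ... | no short = contradiction long short

  prefixStages-continuous : ∀ g β → IsContinuous (prefixStages g β)
  prefixStages-continuous g β = total , stable
    where
    total : ∀ α k → ∃ λ m → prefixStages g β k (initSeg α m) ≢ 0
    total α k = g k , subst (_≢ 0) (sym (prefixStages-long g β k _ long)) λ ()
      where long = ≤-reflexive (sym (length-initSeg α (g k)))
    stable : ∀ k s t → prefixStages g β k s ≢ 0 → prefixStages g β k (s ++ t) ≡ prefixStages g β k s
    stable k s t nz with g k ≤? length s
    ... | no _     = contradiction refl nz
    ... | yes long = trans (prefixStages-long g β k (s ++ t) (≤-trans long (length-++-≤ˡ s)))
                           (cong (λ u → suc (β ⌜ u ⌝)) (take-++-≤ (g k) s t long))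

  prefixQuery : (ℕ → ℕ) → Baire → Continuous
  prefixQuery g β = continuous (prefixStages g β) (prefixStages-continuous g β)

  prefixQuery-· : ∀ g β α k → (prefixQuery g β · α) k ≡ β ⌜ initSeg α (g k) ⌝
  prefixQuery-· g β α k = begin
    (prefixQuery g β · α) k                     ≡⟨ continuous-· _ c α k (g k) (proj₂ (proj₁ c α k)) ⟩
    prefixStages g β k (initSeg α (g k)) ∸ 1    ≡⟨ cong (_∸ 1) (prefixStages-long g β k _ (≤-reflexive (sym length≡))) ⟩
    β ⌜ take (g k) (initSeg α (g k)) ⌝          ≡⟨ cong (β ∘ ⌜_⌝) (take-all (g k) _ (≤-reflexive length≡)) ⟩
    β ⌜ initSeg α (g k) ⌝                       ∎
    where
    open ≡-Reasoning
    c = prefixStages-continuous g β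
    length≡ = length-initSeg α (g k)

  -- glue (λ n _ → n) reads off the first entry of a coded sequence.
  singletonQuery : Baire → Continuous
  singletonQuery = prefixQuery (glue λ n _ → n)

  singletonQuery-· : ∀ β α n → (singletonQuery β · α) ⌜ n ∷ [] ⌝ ≡ β ⌜ initSeg α n ⌝
  singletonQuery-· β α n =
    trans (prefixQuery-· _ β α ⌜ n ∷ [] ⌝) (cong (β ∘ ⌜_⌝ ∘ initSeg α) (glue-∷ _ n []))

  restrictStages : Baire → ℕ → ℕ → List ℕ → ℕ
  restrictStages φ n k = stage φ ⌜ n ∷ dec k ⌝

  restrictStages-continuous : ∀ φ → IsFun φ → ∀ n → IsContinuous (restrictStages φ n)
  restrictStages-continuous φ (total , stable) n = (λ α k → total α ⌜ n ∷ dec k ⌝) , (λ k → stable ⌜ n ∷ dec k ⌝)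

  restrict : Continuous → ℕ → Continuous
  restrict (φ , p) n = continuous (restrictStages φ n) (restrictStages-continuous φ p n)

  restrict-· : ∀ F n α → (restrict F n · α) ≗ (F · α) ↾ (n ∷ [])
  restrict-· (φ , p) n α t =
    continuous-· (restrictStages φ n) (restrictStages-continuous φ p n) α t (proj₁ modulus) (proj₂ modulus)
    where modulus = proj₁ p α ⌜ n ∷ dec t ⌝

  glueStages : (ℕ → Continuous) → ℕ → List ℕ → ℕ
  glueStages Fs k s = glue (λ n j → stage (proj₁ (Fs n)) j s) k

  glueStages-continuous : ∀ Fs → IsContinuous (glueStages Fs)
  glueStages-continuous Fs = glue-continuous (λ n → stage (proj₁ (Fs n))) (λ n → proj₂ (Fs n))

  glueContinuous : (ℕ → Continuous) → Continuous
  glueContinuous Fs = continuous (glueStages Fs) (glueStages-continuous Fs)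

  glueContinuous-· : ∀ Fs α n → (glueContinuous Fs · α) ↾ (n ∷ []) ≗ Fs n · α
  glueContinuous-· Fs α n t = trans
    (continuous-· (glueStages Fs) (glueStages-continuous Fs) α ⌜ n ∷ dec t ⌝ m (subst (_≢ 0) (sym glued) nz))
    (cong (_∸ 1) glued)
    where
    m = proj₁ (proj₁ (proj₂ (Fs n)) α t)
    nz = proj₂ (proj₁ (proj₂ (Fs n)) α t)
    glued = glue-↾ (λ n′ j → stage (proj₁ (Fs n′)) j (initSeg α m)) n t

  -- stage φ k s ∸ 1 ≢ 0 says that s already forces (φ|α)(k) ≢ 0.
  settled⇒·≢0 : ∀ F α k m → stage (proj₁ F) k (initSeg α m) ∸ 1 ≢ 0 → (F · α) k ≢ 0
  settled⇒·≢0 F α k m settled = subst (_≢ 0) (sym (·-at F α k m (settled ∘ cong (_∸ 1)))) settled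

  ·≢0⇒settled : ∀ F α k → (F · α) k ≢ 0 →
                ∃ λ m₀ → ∀ m → m₀ ≤ m → stage (proj₁ F) k (initSeg α m) ∸ 1 ≢ 0
  ·≢0⇒settled (φ , p) α k nz with proj₁ p α k
  ... | m₀ , nz₀ = m₀ , λ m m₀≤m → subst (λ x → x ∸ 1 ≢ 0) (sym (stage-stable p α k nz₀ m₀≤m)) nz

  someOutputNonzero-isΣ⁰ : ∀ F (h : ℕ → ℕ) → IsΣ⁰ one (λ α → ∃ λ n → (F · α) (h n) ≢ 0)
  someOutputNonzero-isΣ⁰ F h = β , λ α → mk⇔ (complete α) (sound α)
    where
    SettledBelowLength : List ℕ → Set
    SettledBelowLength s = ∃ λ n → n < length s × stage (proj₁ F) (h n) s ∸ 1 ≢ 0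

    settledBelowLength? : ∀ s → Dec (SettledBelowLength s)
    settledBelowLength? s = anyUpTo? (λ n → ¬? (stage (proj₁ F) (h n) s ∸ 1 ≟ 0)) (length s)

    β : Baire
    β = indicator ∘ settledBelowLength? ∘ dec

    β≢0⇔ : ∀ s → (β ⌜ s ⌝ ≢ 0) ⇔ SettledBelowLength s
    β≢0⇔ s = ⇔-trans (subst-⇔ (_≢ 0) (cong (indicator ∘ settledBelowLength?) (dec-enc s)))
                     (indicator≢0⇔ (settledBelowLength? s))

    complete : ∀ α → (∃ λ n → (F · α) (h n) ≢ 0) → ∃ λ m → β ⌜ initSeg α m ⌝ ≢ 0
    complete α (n , nz) with ·≢0⇒settled F α (h n) nz
    ... | m₀ , settled = m , from (β≢0⇔ (initSeg α m)) (n , n<m , settled m (m≤m+n m₀ (suc n)))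
      where
      m = m₀ + suc n
      n<m = subst (n <_) (sym (length-initSeg α m)) (m≤n+m (suc n) m₀)

    sound : ∀ α → (∃ λ m → β ⌜ initSeg α m ⌝ ≢ 0) → ∃ λ n → (F · α) (h n) ≢ 0
    sound α (m , nz) with to (β≢0⇔ (initSeg α m)) nz
    ... | n , _ , settled = n , settled⇒·≢0 F α (h n) m settled

  ℰ-cong : ∀ S {α α′} → α ≗ α′ → ℰ S α ⇔ ℰ S α′
  𝒜-cong : ∀ S {α α′} → α ≗ α′ → 𝒜 S α ⇔ 𝒜 S α′
  ℰ-cong one      α≗α′ = ∃-cong-⇔ λ n → subst-⇔ (_≢ 0) (α≗α′ _)
  ℰ-cong (node f) α≗α′ = ∃-cong-⇔ λ n → 𝒜-cong (f _) (α≗α′ ∘ _)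
  𝒜-cong one      α≗α′ = ∀-cong-⇔ λ n → subst-⇔ (_≡ 0) (α≗α′ _)
  𝒜-cong (node f) α≗α′ = ∀-cong-⇔ λ n → ℰ-cong (f _) (α≗α′ ∘ _)

  𝒢-cong : ∀ S {β β′} α → β ≗ β′ → 𝒢 S β α ⇔ 𝒢 S β′ α
  ℱ-cong : ∀ S {β β′} α → β ≗ β′ → ℱ S β α ⇔ ℱ S β′ α
  𝒢-cong one      α β≗β′ = ∃-cong-⇔ λ n → subst-⇔ (_≢ 0) (β≗β′ _)
  𝒢-cong (node f) α β≗β′ = ∃-cong-⇔ λ n → ℱ-cong (f _) α (β≗β′ ∘ _)
  ℱ-cong one      α β≗β′ = ∀-cong-⇔ λ n → subst-⇔ (_≡ 0) (β≗β′ _)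
  ℱ-cong (node f) α β≗β′ = ∀-cong-⇔ λ n → 𝒢-cong (f _) α (β≗β′ ∘ _)

  _≼ᶜ_ : (Baire → Set) → (Baire → Set) → Set
  X ≼ᶜ Y = Σ Continuous λ F → ∀ α → X α ⇔ Y (F · α)

  ≼ᶜ⇒≼ : ∀ {X Y} → X ≼ᶜ Y → X ≼ Y
  ≼ᶜ⇒≼ ((φ , p) , reduces) = φ , p , reduces

  𝒢≼ℰ : ∀ S β → 𝒢 S β ≼ᶜ ℰ S
  ℱ≼𝒜 : ∀ S β → ℱ S β ≼ᶜ 𝒜 S
  𝒢≼ℰ one β = singletonQuery β , λ α →
    ∃-cong-⇔ λ n → subst-⇔ (_≢ 0) (sym (singletonQuery-· β α n))
  𝒢≼ℰ (node f) β = glueContinuous (proj₁ ∘ IH) , λ α → ∃-cong-⇔ λ n →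
    ⇔-trans (proj₂ (IH n) α) (𝒜-cong (f _) (sym ∘ glueContinuous-· (proj₁ ∘ IH) α n))
    where IH = λ n → ℱ≼𝒜 (f _) (β ↾ (n ∷ []))
  ℱ≼𝒜 one β = singletonQuery β , λ α →
    ∀-cong-⇔ λ n → subst-⇔ (_≡ 0) (sym (singletonQuery-· β α n))
  ℱ≼𝒜 (node f) β = glueContinuous (proj₁ ∘ IH) , λ α → ∀-cong-⇔ λ n →
    ⇔-trans (proj₂ (IH n) α) (ℰ-cong (f _) (sym ∘ glueContinuous-· (proj₁ ∘ IH) α n))
    where IH = λ n → 𝒢≼ℰ (f _) (β ↾ (n ∷ []))

  preimage-ℰ-isΣ⁰ : ∀ S F → IsΣ⁰ S (ℰ S ∘ (F ·_))
  preimage-𝒜-isΠ⁰ : ∀ S F → IsΠ⁰ S (𝒜 S ∘ (F ·_))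
  preimage-ℰ-isΣ⁰ one F = someOutputNonzero-isΣ⁰ F λ n → ⌜ n ∷ [] ⌝
  preimage-ℰ-isΣ⁰ (node f) F = glue (proj₁ ∘ IH) , λ α → ∃-cong-⇔ λ n →
    ⇔-trans (𝒜-cong (f _) (sym ∘ restrict-· F n α))
            (⇔-trans (proj₂ (IH n) α) (ℱ-cong (f _) α (sym ∘ glue-↾ (proj₁ ∘ IH) n)))
    where IH = λ n → preimage-𝒜-isΠ⁰ (f _) (restrict F n)
  preimage-𝒜-isΠ⁰ one F with preimage-ℰ-isΣ⁰ one F
  ... | β , ℰ∘F≐𝒢 = β , λ α →
    ⇔-trans (∀≡0⇔¬∃≢0 λ n → (F · α) ⌜ n ∷ [] ⌝)
            (⇔-trans (¬-cong-⇔ (ℰ∘F≐𝒢 α)) (⇔-sym (∀≡0⇔¬∃≢0 λ n → β ⌜ initSeg α n ⌝)))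
  preimage-𝒜-isΠ⁰ (node f) F = glue (proj₁ ∘ IH) , λ α → ∀-cong-⇔ λ n →
    ⇔-trans (ℰ-cong (f _) (sym ∘ restrict-· F n α))
            (⇔-trans (proj₂ (IH n) α) (𝒢-cong (f _) α (sym ∘ glue-↾ (proj₁ ∘ IH) n)))
    where IH = λ n → preimage-ℰ-isΣ⁰ (f _) (restrict F n)

  inClass⇔≼ : ∀ {L : Baire → Set} {P : Baire → Baire → Set} →
              (∀ β → P β ≼ᶜ L) → (∀ F → ∃ λ β → (L ∘ (F ·_)) ≐ P β) →
              ∀ X → (∃ λ β → X ≐ P β) ⇔ X ≼ L
  inClass⇔≼ {L} P≼L preimage X = mk⇔
    (λ (β , X≐Pβ) → let F , Pβ⇔L∘F = P≼L β in
      ≼ᶜ⇒≼ {Y = L} (F , λ α → ⇔-trans (X≐Pβ α) (Pβ⇔L∘F α)))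
    (λ (φ , p , X⇔L∘φ) → let β , L∘φ≐Pβ = preimage (φ , p) in
      β , λ α → ⇔-trans (X⇔L∘φ α) (L∘φ≐Pβ α))

open Reductions

theorem3p14 : (C : Coding) → (S : Hrs) → (X : Baire → Set) →
    (WithCoding.IsΣ⁰ C S X ⇔ WithCoding._≼_ C X (WithCoding.ℰ C S))
    × (WithCoding.IsΠ⁰ C S X ⇔ WithCoding._≼_ C X (WithCoding.𝒜 C S))
theorem3p14 C S X = inClass⇔≼ C {L = WithCoding.ℰ C S} (𝒢≼ℰ C S) (preimage-ℰ-isΣ⁰ C S) X
                  , inClass⇔≼ C {L = WithCoding.𝒜 C S} (ℱ≼𝒜 C S) (preimage-𝒜-isΠ⁰ C S) X
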